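{- Let $q$ be a prime power and $0<k<n$, $0\le t\le k$ integers. Suppose $X,Y\in\mathcal{C}_t(n,k)$ satisfy $\dim(X\cap Y)=k-1$ but $X\cap Y\notin\mathcal{C}_t(n,k-1)$. Then there exists a $k$-dimensional subspace $Z$ with $X\cap Y\subset Z\subset\langle X,Y\rangle$ and $Z\notin\mathcal{C}_t(n,k)$.
   Context: Let $V=\mathbb{F}_q^n$. An $[n,m]$-linear code is an $m$-dimensional subspace of $V$; $\mathcal{C}_t(n,m)$ denotes the set of $[n,m]$-codes such that any $t$ columns of a generator matrix (an $m\times n$ matrix whose rows form a basis) are linearly independent. -}

module Defs where

open import Level using (Level; _⊔_) renaming (suc to lsuc)
open import Data.Nat using (ℕ)
open import Data.Fin using (Fin)
open import Data.Product using (Σ; ∃; ∃₂; _×_)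
open import Relation.Nullary using (¬_)
open import Relation.Unary using (Pred; _∩_)
open import Relation.Binary.PropositionalEquality using (_≡_)
open import Function.Definitions using (Injective)
open import Algebra.Bundles using (CommutativeRing)
import Algebra.Definitions.RawMonoid as RawMonoidDefs

record IsField {c ℓ : Level} (R : CommutativeRing c ℓ) : Set (c ⊔ ℓ) where
  open CommutativeRing R
  field
    1≉0 : ¬ (1# ≈ 0#)
    inverse : ∀ x → ¬ (x ≈ 0#) → ∃ λ y → (x * y) ≈ 1#

record FiniteField (c ℓ : Level) : Set (lsuc (c ⊔ ℓ)) where
  field
    cring     : CommutativeRing c ℓ
    isField   : IsField cring
    q         : ℕ
    enum      : Fin q → CommutativeRing.Carrier cring
    enum-inj  : ∀ i j → CommutativeRing._≈_ cring (enum i) (enum j) → i ≡ j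
    enum-surj : ∀ x → ∃ λ i → CommutativeRing._≈_ cring (enum i) x
  open CommutativeRing cring public

module LinAlg {c ℓ : Level} (F : FiniteField c ℓ) where
  open FiniteField F
  open RawMonoidDefs +-rawMonoid using (sum)

  V : ℕ → Set c
  V n = Fin n → Carrier

  Sub : ℕ → Set (lsuc (c ⊔ ℓ))
  Sub n = Pred (V n) (c ⊔ ℓ)

  _≈ᵥ_ : ∀ {n} → V n → V n → Set ℓ
  u ≈ᵥ v = ∀ j → u j ≈ v j

  lincomb : ∀ {m n} → (Fin m → Carrier) → (Fin m → V n) → V n
  lincomb μ b j = sum (λ i → μ i * b i j)

  record IsSubspace {n} (S : Sub n) : Set (c ⊔ ℓ) where
    field
      resp  : ∀ {u v} → u ≈ᵥ v → S u → S v
      zero∈ : S (λ _ → 0#)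
      +∈    : ∀ {u v} → S u → S v → S (λ j → u j + v j)
      *∈    : ∀ a {u} → S u → S (λ j → a * u j)

  LinIndep : ∀ {m n} → (Fin m → V n) → Set (c ⊔ ℓ)
  LinIndep b = ∀ μ → lincomb μ b ≈ᵥ (λ _ → 0#) → ∀ i → μ i ≈ 0#

  -- b is a basis of S, i.e. the rows of a generator matrix of S
  IsBasis : ∀ {m n} → Sub n → (Fin m → V n) → Set (c ⊔ ℓ)
  IsBasis S b = LinIndep b × (∀ i → S (b i))
                × (∀ v → S v → ∃ λ μ → v ≈ᵥ lincomb μ b)

  HasDim : ∀ {n} → Sub n → ℕ → Set (c ⊔ ℓ)
  HasDim {n} S m = IsSubspace S × Σ (Fin m → V n) (IsBasis S)

  ColsIndep : ∀ {m n} → ℕ → (Fin m → V n) → Set (c ⊔ ℓ)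
  ColsIndep {m} {n} t G =
    ∀ (col : Fin t → Fin n) → Injective _≡_ _≡_ col →
    ∀ (μ : Fin t → Carrier) →
    (∀ i → sum (λ s → μ s * G i (col s)) ≈ 0#) → ∀ s → μ s ≈ 0#

  -- S ∈ C_t(n,m): S is an [n,m]-code and any t columns of a generator matrix
  -- are linearly independent (we require it for every generator matrix; the
  -- property is independent of the choice).
  InC : ∀ {n} → ℕ → Sub n → ℕ → Set (c ⊔ ℓ)
  InC {n} t S m = HasDim S m × (∀ (G : Fin m → V n) → IsBasis S G → ColsIndep t G)

  span₂ : ∀ {n} → Sub n → Sub n → Sub n
  span₂ X Y v = ∃₂ λ x y → X x × Y y × (v ≈ᵥ (λ j → x j + y j))

{-# OPTIONS --safe #-}
-- A choice of t columns of a generator matrix of S is dependent exactly when a nonzero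
-- form v ↦ Σₛ μₛ v(colₛ), supported on those t coordinates, vanishes on S; this only
-- depends on S. Take such a form φ vanishing on W = X ∩ Y. As X, Y ∈ C_t, φ is nonzero at
-- some x ∈ X and y ∈ Y, and z = φ(y) x − φ(x) y lies in X + Y and in ker φ but not in W
-- (otherwise y ∈ X ∩ Y). So Z = W + ⟨z⟩ has dimension k, lies between W and X + Y, and is
-- still killed by φ, whence Z ∉ C_t. Over a finite field the failure of W ∈ C_t produces
-- φ explicitly, by exhaustive search over the columns and coefficients.
module Submission where

open import Defs
open import Data.Nat using (ℕ; zero; suc; _<_; _≤_; _∸_)
open import Data.Fin using (Fin; zero; suc)
open import Data.Fin.Properties using (any?; all?; ¬∀⟶∃¬) renaming (_≟_ to _≟ᶠ_)
open import Data.Vec.Functional using ([]; _∷_; head; tail)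
open import Data.Product using (Σ; ∃; ∃₂; _×_; _,_; proj₁; proj₂)
open import Function.Base using (_∘_)
open import Function.Definitions using (Injective)
open import Level using (Level; _⊔_)
open import Relation.Nullary using (¬_; Dec; yes; no; contradiction)
open import Relation.Nullary.Decidable using (map′; _×-dec_; _→-dec_; ¬?)
open import Relation.Unary using (Pred; Decidable; _∩_; _⊆_)
import Relation.Binary.Definitions as B
open import Relation.Binary.PropositionalEquality as ≡ using (_≡_; _≗_; cong)

any-function? : ∀ {p} m t {P : Pred (Fin t → Fin m) p} →
                (∀ {f g} → f ≗ g → P f → P g) → Decidable P → Dec (∃ P)
any-function? m zero resp P? =
  map′ (λ p → [] , p) (λ (f , p) → resp (λ ()) p) (P? [])
any-function? m (suc t) resp P? =
  map′ (λ (a , f , p) → a ∷ f , p) (λ (f , p) → head f , tail f , resp (η f) p)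
       (any? λ a → any-function? m t (resp ∘ ∷-cong) (P? ∘ (a ∷_)))
  where
  ∷-cong : ∀ {a f g} → f ≗ g → (a ∷ f) ≗ (a ∷ g)
  ∷-cong f≗g zero    = ≡.refl
  ∷-cong f≗g (suc i) = f≗g i
  η : ∀ (f : Fin (suc t) → Fin m) → f ≗ (head f ∷ tail f)
  η f zero    = ≡.refl
  η f (suc i) = ≡.refl

injective? : ∀ {t n} (f : Fin t → Fin n) → Dec (Injective _≡_ _≡_ f)
injective? f = map′ (λ inj {x} {y} → inj x y) (λ inj x y → inj)
  (all? λ x → all? λ y → (f x ≟ᶠ f y) →-dec (x ≟ᶠ y))

module _ {c ℓ : Level} (F : FiniteField c ℓ) where
  open FiniteField F hiding (zero)
  open LinAlg F
  open import Algebra.Properties.Semiring.Sum semiring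
    using (sum; sum-cong-≋; sum-replicate-zero; ∑-distrib-+; *-distribˡ-sum)
  open import Algebra.Properties.Group +-group using (//-rightDividesʳ; ⁻¹-injective; ε⁻¹≈ε)
  open import Algebra.Properties.Ring ring using (-1*x≈-x; -‿distribˡ-*)
  open import Algebra.Properties.CommutativeSemigroup +-commutativeSemigroup
    using (interchange)
  open import Algebra.Properties.CommutativeSemigroup *-commutativeSemigroup
    using (x∙yz≈y∙xz)
  open import Relation.Binary.Reasoning.Setoid setoid

  _≟_ : B.Decidable _≈_
  x ≟ y with enum-surj x | enum-surj y
  ... | i , i↦x | j , j↦y =
    map′ (λ { ≡.refl → trans (sym i↦x) j↦y })
         (λ x≈y → enum-inj i j (trans i↦x (trans x≈y (sym j↦y))))
         (i ≟ᶠ j)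

  -≉0 : ∀ {a} → ¬ a ≈ 0# → ¬ - a ≈ 0#
  -≉0 a≉0 -a≈0 = a≉0 (⁻¹-injective (trans -a≈0 (sym ε⁻¹≈ε)))

  any-vector? : ∀ t {p} {P : Pred (V t) p} →
                (∀ {μ ν} → μ ≈ᵥ ν → P μ → P ν) → Decidable P → Dec (∃ P)
  any-vector? t {P = P} resp P? =
    map′ (λ (ι , p) → enum ∘ ι , p)
         (λ (μ , p) → index ∘ μ , resp (λ s → sym (proj₂ (enum-surj (μ s)))) p)
         (any-function? q t (λ ι≗κ → resp (λ s → reflexive (cong enum (ι≗κ s))))
                            (P? ∘ (enum ∘_)))
    where
    index : Carrier → Fin q
    index x = proj₁ (enum-surj x)

  _+⟨_⟩ : ∀ {n} → Sub n → V n → Sub n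
  (S +⟨ z ⟩) v = ∃₂ λ a w → S w × v ≈ᵥ (λ j → a * z j + w j)

  form : ∀ {t n} → (Fin t → Fin n) → V t → V n → Carrier
  form col μ v = sum (λ s → μ s * v (col s))

  form-cong-coeff : ∀ {t n} {col : Fin t → Fin n} {μ ν v} →
                    μ ≈ᵥ ν → form col μ v ≈ form col ν v
  form-cong-coeff μ≈ν = sum-cong-≋ (λ s → *-congʳ (μ≈ν s))

  form-cong-col : ∀ {t n} {f g : Fin t → Fin n} {μ v} → f ≗ g → form f μ v ≈ form g μ v
  form-cong-col {v = v} f≗g = sum-cong-≋ (λ s → *-congˡ (reflexive (cong v (f≗g s))))

  module _ {t n} (col : Fin t → Fin n) (μ : V t) where

    form-cong : ∀ {u v} → u ≈ᵥ v → form col μ u ≈ form col μ v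
    form-cong u≈v = sum-cong-≋ (λ s → *-congˡ (u≈v (col s)))

    form-0 : form col μ (λ _ → 0#) ≈ 0#
    form-0 = trans (sum-cong-≋ (λ s → zeroʳ (μ s))) (sum-replicate-zero t)

    form-+ : ∀ u v → form col μ (λ j → u j + v j) ≈ form col μ u + form col μ v
    form-+ u v = trans (sum-cong-≋ (λ s → distribˡ (μ s) _ _))
                       (∑-distrib-+ (λ s → μ s * u (col s)) (λ s → μ s * v (col s)))

    form-* : ∀ a v → form col μ (λ j → a * v j) ≈ a * form col μ v
    form-* a v = trans (sum-cong-≋ (λ s → x∙yz≈y∙xz (μ s) a _))
                       (sym (*-distribˡ-sum a (λ s → μ s * v (col s))))

    form-*+ : ∀ a u v → form col μ (λ j → a * u j + v j) ≈ a * form col μ u + form col μ v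
    form-*+ a u v = trans (form-+ (λ j → a * u j) v) (+-congʳ (form-* a u))

    form-lincomb≈0 : ∀ {m} (a : V m) (b : Fin m → V n) →
                     (∀ i → form col μ (b i) ≈ 0#) → form col μ (lincomb a b) ≈ 0#
    form-lincomb≈0 {zero}  a b b≈0 = form-0
    form-lincomb≈0 {suc m} a b b≈0 = begin
      form col μ (lincomb a b)                     ≈⟨ form-*+ (head a) (head b) rest ⟩
      head a * form col μ (head b) + form col μ rest
        ≈⟨ +-cong (trans (*-congˡ (b≈0 zero)) (zeroʳ _))
                  (form-lincomb≈0 (tail a) (tail b) (b≈0 ∘ suc)) ⟩
      0# + 0#                                      ≈⟨ +-identityˡ 0# ⟩
      0#                                           ∎
      where
      rest : V n
      rest = lincomb (tail a) (tail b)

    spanned-annihilated : ∀ {m} {S : Sub n} {b : Fin m → V n} →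
                          (∀ v → S v → ∃ λ a → v ≈ᵥ lincomb a b) →
                          (∀ i → form col μ (b i) ≈ 0#) → ∀ {v} → S v → form col μ v ≈ 0#
    spanned-annihilated {b = b} b-spans b≈0 {v} v∈S with b-spans v v∈S
    ... | a , v≈ab = trans (form-cong v≈ab) (form-lincomb≈0 a b b≈0)

    +⟨⟩-annihilated : ∀ {S : Sub n} {z} → (∀ {v} → S v → form col μ v ≈ 0#) →
                      form col μ z ≈ 0# → ∀ {v} → (S +⟨ z ⟩) v → form col μ v ≈ 0#
    +⟨⟩-annihilated {z = z} S≈0 z≈0 {v} (a , w , w∈S , v≈az+w) = begin
      form col μ v                               ≈⟨ form-cong v≈az+w ⟩
      form col μ (λ j → a * z j + w j)           ≈⟨ form-*+ a z w ⟩
      a * form col μ z + form col μ w            ≈⟨ +-cong (*-congˡ z≈0) (S≈0 w∈S) ⟩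
      a * 0# + 0#                                ≈⟨ trans (+-identityʳ _) (zeroʳ a) ⟩
      0#                                         ∎

  module _ {n} {S : Sub n} (S-sub : IsSubspace S) where
    open IsSubspace S-sub

    lincomb∈ : ∀ {m} (a : V m) (b : Fin m → V n) → (∀ i → S (b i)) → S (lincomb a b)
    lincomb∈ {zero}  a b b∈S = zero∈
    lincomb∈ {suc m} a b b∈S =
      +∈ (*∈ (head a) (b∈S zero)) (lincomb∈ (tail a) (tail b) (b∈S ∘ suc))

    -∈ : ∀ {u} → S u → S (λ j → - u j)
    -∈ u∈S = resp (λ j → -1*x≈-x _) (*∈ (- 1#) u∈S)

    *+∈⇒∈ : ∀ {a z w} → ¬ a ≈ 0# → S (λ j → a * z j + w j) → S w → S z
    *+∈⇒∈ {a} {z} {w} a≉0 az+w∈S w∈S with IsField.inverse isField a a≉0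
    ... | a⁻¹ , aa⁻¹≈1 = resp cancel (*∈ a⁻¹ (+∈ az+w∈S (-∈ w∈S)))
      where
      cancel : ∀ j → a⁻¹ * ((a * z j + w j) + - w j) ≈ z j
      cancel j = begin
        a⁻¹ * ((a * z j + w j) + - w j) ≈⟨ *-congˡ (//-rightDividesʳ (w j) (a * z j)) ⟩
        a⁻¹ * (a * z j)                 ≈⟨ *-assoc a⁻¹ a (z j) ⟨
        (a⁻¹ * a) * z j                 ≈⟨ *-congʳ (trans (*-comm a⁻¹ a) aa⁻¹≈1) ⟩
        1# * z j                        ≈⟨ *-identityˡ (z j) ⟩
        z j                             ∎

  ⊆span₂ˡ : ∀ {n} {X Y : Sub n} → IsSubspace Y → X ⊆ span₂ X Y
  ⊆span₂ˡ Y-sub x∈X = _ , _ , x∈X , IsSubspace.zero∈ Y-sub , λ j → sym (+-identityʳ _)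

  span₂-isSubspace : ∀ {n} {X Y : Sub n} →
                     IsSubspace X → IsSubspace Y → IsSubspace (span₂ X Y)
  span₂-isSubspace X-sub Y-sub = record
    { resp  = λ u≈v (x , y , x∈X , y∈Y , u≈x+y) →
                x , y , x∈X , y∈Y , λ j → trans (sym (u≈v j)) (u≈x+y j)
    ; zero∈ = _ , _ , X.zero∈ , Y.zero∈ , λ j → sym (+-identityʳ 0#)
    ; +∈    = λ (x , y , x∈X , y∈Y , u≈x+y) (x′ , y′ , x′∈X , y′∈Y , v≈x′+y′) →
                _ , _ , X.+∈ x∈X x′∈X , Y.+∈ y∈Y y′∈Y ,
                λ j → trans (+-cong (u≈x+y j) (v≈x′+y′ j))
                            (interchange (x j) (y j) (x′ j) (y′ j))
    ; *∈    = λ a (x , y , x∈X , y∈Y , u≈x+y) →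
                _ , _ , X.*∈ a x∈X , Y.*∈ a y∈Y ,
                λ j → trans (*-congˡ (u≈x+y j)) (distribˡ a (x j) (y j))
    }
    where
    module X = IsSubspace X-sub
    module Y = IsSubspace Y-sub

  module _ {n} {S : Sub n} {z : V n} where

    ⊆+⟨⟩ : S ⊆ S +⟨ z ⟩
    ⊆+⟨⟩ w∈S = 0# , _ , w∈S , λ j → sym (trans (+-congʳ (zeroˡ (z j))) (+-identityˡ _))

    +⟨⟩-least : ∀ {T : Sub n} → IsSubspace T → T z → S ⊆ T → S +⟨ z ⟩ ⊆ T
    +⟨⟩-least T-sub z∈T S⊆T (a , w , w∈S , v≈az+w) =
      resp (λ j → sym (v≈az+w j)) (+∈ (*∈ a z∈T) (S⊆T w∈S))
      where open IsSubspace T-sub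

    +⟨⟩-isSubspace : IsSubspace S → IsSubspace (S +⟨ z ⟩)
    +⟨⟩-isSubspace S-sub = record
      { resp  = λ u≈v (a , w , w∈S , u≈az+w) →
                  a , w , w∈S , λ j → trans (sym (u≈v j)) (u≈az+w j)
      ; zero∈ = 0# , _ , zero∈ , λ j → sym (trans (+-identityʳ _) (zeroˡ (z j)))
      ; +∈    = λ (a , w , w∈S , u≈az+w) (a′ , w′ , w′∈S , v≈a′z+w′) →
                  a + a′ , _ , +∈ w∈S w′∈S ,
                  λ j → trans (+-cong (u≈az+w j) (v≈a′z+w′ j))
                       (trans (interchange (a * z j) (w j) (a′ * z j) (w′ j))
                              (+-congʳ (sym (distribʳ (z j) a a′))))
      ; *∈    = λ r (a , w , w∈S , u≈az+w) →
                  r * a , _ , *∈ r w∈S ,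
                  λ j → trans (*-congˡ (u≈az+w j))
                       (trans (distribˡ r (a * z j) (w j)) (+-congʳ (sym (*-assoc r a (z j)))))
      }
      where open IsSubspace S-sub

    ∷-isBasis : ∀ {m} {b : Fin m → V n} → IsSubspace S → IsBasis S b → ¬ S z →
                IsBasis (S +⟨ z ⟩) (z ∷ b)
    ∷-isBasis {b = b} S-sub (b-indep , b∈S , b-spans) z∉S =
      indep , ∈+⟨⟩ , spans
      where
      open IsSubspace S-sub
      indep : LinIndep (z ∷ b)
      indep a a·zb≈0 with head a ≟ 0#
      ... | no a₀≉0 = contradiction
              (*+∈⇒∈ S-sub a₀≉0 (resp (λ j → sym (a·zb≈0 j)) zero∈)
                                 (lincomb∈ S-sub (tail a) b b∈S))
              z∉S
      ... | yes a₀≈0 = λ { zero → a₀≈0 ; (suc i) → tail≈0 i }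
        where
        tail≈0 = b-indep (tail a) λ j → begin
          lincomb (tail a) b j               ≈⟨ +-identityˡ _ ⟨
          0# + lincomb (tail a) b j          ≈⟨ +-congʳ (trans (*-congʳ a₀≈0) (zeroˡ (z j))) ⟨
          head a * z j + lincomb (tail a) b j ≈⟨ a·zb≈0 j ⟩
          0#                                 ∎
      ∈+⟨⟩ : ∀ i → (S +⟨ z ⟩) ((z ∷ b) i)
      ∈+⟨⟩ zero    = 1# , _ , zero∈ , λ j → sym (trans (+-identityʳ _) (*-identityˡ (z j)))
      ∈+⟨⟩ (suc i) = ⊆+⟨⟩ (b∈S i)
      spans : ∀ v → (S +⟨ z ⟩) v → ∃ λ a → v ≈ᵥ lincomb a (z ∷ b)
      spans v (a , w , w∈S , v≈az+w) with b-spans w w∈S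
      ... | μ , w≈μb = a ∷ μ , λ j → trans (v≈az+w j) (+-congˡ (w≈μb j))

    +⟨⟩-hasDim : ∀ {m} → HasDim S m → ¬ S z → HasDim (S +⟨ z ⟩) (suc m)
    +⟨⟩-hasDim (S-sub , b , b-basis) z∉S =
      +⟨⟩-isSubspace S-sub , z ∷ b , ∷-isBasis S-sub b-basis z∉S

  record ColumnDependency {n} (t : ℕ) (S : Sub n) : Set (c ⊔ ℓ) where
    field
      col         : Fin t → Fin n
      col-inj     : Injective _≡_ _≡_ col
      coeff       : V t
      pivot       : Fin t
      coeff≉0     : ¬ coeff pivot ≈ 0#
      annihilates : ∀ {v} → S v → form col coeff v ≈ 0#

  NontrivialAnnihilator : ∀ {t n m} → (Fin m → V n) → (Fin t → Fin n) → V t → Set ℓ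
  NontrivialAnnihilator b col μ = (∀ i → form col μ (b i) ≈ 0#) × ∃ λ s → ¬ μ s ≈ 0#

  dependent? : ∀ {t n m} (b : Fin m → V n) →
               Dec (∃ λ col → Injective _≡_ _≡_ col × ∃ (NontrivialAnnihilator {t} b col))
  dependent? {t} {n} b = any-function? n t respects-≗ λ col →
    injective? col ×-dec any-vector? t (respects-≈ col) λ μ →
      all? (λ i → form col μ (b i) ≟ 0#) ×-dec any? (λ s → ¬? (μ s ≟ 0#))
    where
    respects-≈ : ∀ col {μ ν} → μ ≈ᵥ ν →
                 NontrivialAnnihilator b col μ → NontrivialAnnihilator b col ν
    respects-≈ col μ≈ν (b≈0 , s , μₛ≉0) =
      (λ i → trans (sym (form-cong-coeff {v = b i} μ≈ν)) (b≈0 i)) ,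
      s , λ νₛ≈0 → μₛ≉0 (trans (μ≈ν s) νₛ≈0)
    respects-≗ : ∀ {f g} → f ≗ g →
                 Injective _≡_ _≡_ f × ∃ (NontrivialAnnihilator b f) →
                 Injective _≡_ _≡_ g × ∃ (NontrivialAnnihilator b g)
    respects-≗ f≗g (f-inj , μ , b≈0 , s≉0) =
      (λ gx≡gy → f-inj (≡.trans (f≗g _) (≡.trans gx≡gy (≡.sym (f≗g _))))) ,
      μ , (λ i → trans (sym (form-cong-col {v = b i} f≗g)) (b≈0 i)) , s≉0

  module _ {n t m : ℕ} {S : Sub n} where

    InC⇒form≉0 : ∀ {col : Fin t → Fin n} {μ : V t} {s} → InC t S m →
                 Injective _≡_ _≡_ col → ¬ μ s ≈ 0# → ∃ λ v → S v × ¬ form col μ v ≈ 0#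
    InC⇒form≉0 {col} {μ} {s} ((_ , G , G-basis@(_ , G∈S , _)) , S∈C) col-inj μₛ≉0
      with ¬∀⟶∃¬ m _ (λ i → form col μ (G i) ≟ 0#)
                 (λ G≈0 → μₛ≉0 (S∈C G G-basis col col-inj μ G≈0 s))
    ... | i , Gᵢ≉0 = G i , G∈S i , Gᵢ≉0

    dependency⇒¬InC : ColumnDependency t S → ¬ InC t S m
    dependency⇒¬InC d S∈C =
      let v , v∈S , φv≉0 = InC⇒form≉0 S∈C col-inj coeff≉0 in φv≉0 (annihilates v∈S)
      where open ColumnDependency d

    ¬InC⇒dependency : HasDim S m → ¬ InC t S m → ColumnDependency t S
    ¬InC⇒dependency S-dim@(_ , b , _ , b∈S , b-spans) S∉C with dependent? b
    ... | yes (col , col-inj , μ , b≈0 , s , μₛ≉0) = record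
      { col = col ; col-inj = col-inj ; coeff = μ ; pivot = s ; coeff≉0 = μₛ≉0
      ; annihilates = spanned-annihilated col μ b-spans b≈0 }
    ... | no ¬dependent = contradiction (S-dim , cols-indep) S∉C
      where
      cols-indep : ∀ G → IsBasis S G → ColsIndep t G
      cols-indep G (_ , _ , G-spans) col col-inj μ G≈0 s with μ s ≟ 0#
      ... | yes μₛ≈0 = μₛ≈0
      ... | no μₛ≉0  = contradiction
              (col , (λ {x y} → col-inj) , μ ,
               (λ i → spanned-annihilated col μ G-spans G≈0 (b∈S i)) , s , μₛ≉0)
              ¬dependent

  exchange-vector : ∀ {n t} {X Y : Sub n} → IsSubspace X → IsSubspace Y →
                    {col : Fin t → Fin n} {μ : V t} → (∀ {v} → (X ∩ Y) v → form col μ v ≈ 0#) →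
                    ∀ {x y} → X x → Y y → ¬ form col μ x ≈ 0# → ¬ form col μ y ≈ 0# →
                    ∃ λ z → span₂ X Y z × form col μ z ≈ 0# × ¬ (X ∩ Y) z
  exchange-vector {n} {X = X} {Y} X-sub Y-sub {col} {μ} W≈0 {x} {y} x∈X y∈Y φx≉0 φy≉0 =
    z , z∈X+Y , φz≈0 , z∉X∩Y
    where
    module X = IsSubspace X-sub
    module Y = IsSubspace Y-sub
    φ : V n → Carrier
    φ = form col μ
    z : V n
    z j = φ y * x j + - φ x * y j
    z∈X+Y : span₂ X Y z
    z∈X+Y = _ , _ , X.*∈ (φ y) x∈X , Y.*∈ (- φ x) y∈Y , λ j → refl
    φz≈0 : φ z ≈ 0#
    φz≈0 = begin
      φ z                                  ≈⟨ form-*+ col μ (φ y) x (λ j → - φ x * y j) ⟩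
      φ y * φ x + φ (λ j → - φ x * y j)
        ≈⟨ +-cong (*-comm (φ y) (φ x)) (form-* col μ (- φ x) y) ⟩
      φ x * φ y + - φ x * φ y              ≈⟨ +-congˡ (-‿distribˡ-* (φ x) (φ y)) ⟨
      φ x * φ y + - (φ x * φ y)            ≈⟨ -‿inverseʳ (φ x * φ y) ⟩
      0#                                   ∎
    z∉X∩Y : ¬ (X ∩ Y) z
    z∉X∩Y (z∈X , _) = φy≉0 (W≈0 (y∈X , y∈Y))
      where
      y∈X : X y
      y∈X = *+∈⇒∈ X-sub (-≉0 φx≉0) (X.resp (λ j → +-comm _ _) z∈X) (X.*∈ (φ y) x∈X)

  exchange-subspace : ∀ {n t k} {X Y : Sub n} → InC t X (suc k) → InC t Y (suc k) →
                      HasDim (X ∩ Y) k → ColumnDependency t (X ∩ Y) →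
                      Σ (Sub n) λ Z → HasDim Z (suc k) × (X ∩ Y) ⊆ Z × Z ⊆ span₂ X Y
                                    × ColumnDependency t Z
  exchange-subspace X∈C@((X-sub , _) , _) Y∈C@((Y-sub , _) , _) W-dim d =
    let x , x∈X , φx≉0 = InC⇒form≉0 {col = col} {coeff} X∈C col-inj coeff≉0
        y , y∈Y , φy≉0 = InC⇒form≉0 {col = col} {coeff} Y∈C col-inj coeff≉0
        z , z∈X+Y , φz≈0 , z∉W =
          exchange-vector X-sub Y-sub {col} {coeff} annihilates x∈X y∈Y φx≉0 φy≉0
    in _ +⟨ z ⟩ , +⟨⟩-hasDim W-dim z∉W , ⊆+⟨⟩ ,
       +⟨⟩-least (span₂-isSubspace X-sub Y-sub) z∈X+Y (⊆span₂ˡ Y-sub ∘ proj₁) ,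
       record { col = col ; col-inj = col-inj ; coeff = coeff ; pivot = pivot
              ; coeff≉0 = coeff≉0 ; annihilates = +⟨⟩-annihilated col coeff annihilates φz≈0 }
    where open ColumnDependency d

lemma4p6 : ∀ {c ℓ} (F : FiniteField c ℓ) → let open LinAlg F in
    (n k t : ℕ) → 0 < k → k < n → t ≤ k →
    (X Y : Sub n) → InC t X k → InC t Y k →
    HasDim (X ∩ Y) (k ∸ 1) → ¬ InC t (X ∩ Y) (k ∸ 1) →
    Σ (Sub n) λ Z → HasDim Z k × (X ∩ Y) ⊆ Z × Z ⊆ span₂ X Y × ¬ InC t Z k
lemma4p6 F n (suc k) t _ _ _ X Y X∈C Y∈C W-dim W∉C =
  let Z , Z-dim , W⊆Z , Z⊆X+Y , Z-dependent =
        exchange-subspace F X∈C Y∈C W-dim (¬InC⇒dependency F W-dim W∉C)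
  in Z , Z-dim , W⊆Z , Z⊆X+Y , dependency⇒¬InC F Z-dependent
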